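{- If a connected graph $G$ admits a pairing resolving set, then $o(G)=\mathcal{R}$.
   Context: A set $W\subseteq V(G)$ is a resolving set of a connected graph $G$ if for all distinct $x,y\in V(G)$ there is $z\in W$ with $d(x,z)\neq d(y,z)$, $d$ the shortest-path distance. A set $A=\{\{u_1,w_1\},\ldots,\{u_k,w_k\}\}$ of $2$-subsets of $V(G)$ with $|\bigcup_{i=1}^k\{u_i,w_i\}|=2k$ is a pairing resolving set of $G$ if every set $\{x_1,\ldots,x_k\}$ with $x_i\in\{u_i,w_i\}$ for all $i\in\{1,\ldots,k\}$ is a resolving set of $G$. In the Maker-Breaker resolving game, Resolver and Spoiler alternately select (without skipping) a not-yet-selected vertex; Resolver wins if at some point his vertices form a resolving set, otherwise Spoiler wins. $o(G)=\mathcal{R}$ means Resolver has a winning strategy both in the game where Resolver moves first and in the game where Spoiler moves first. -}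

module Defs where

open import Data.Nat using (ℕ; zero; suc; _<_)
open import Data.Fin using (Fin; _≟_)
open import Data.Bool using (Bool; true; false; if_then_else_)
open import Data.Product using (Σ; ∃; ∃-syntax; _×_; _,_)
open import Relation.Nullary using (¬_)
open import Relation.Nullary.Decidable using (⌊_⌋)
open import Relation.Binary.PropositionalEquality using (_≡_; _≢_)

record Graph : Set₁ where
  field
    n     : ℕ
    Adj   : Fin n → Fin n → Set
    sym   : ∀ {x y} → Adj x y → Adj y x
    irref : ∀ {x} → ¬ Adj x x

open Graph public

data Walk (G : Graph) : Fin (n G) → Fin (n G) → ℕ → Set where
  here : ∀ {x} → Walk G x x zero
  step : ∀ {x y z k} → Adj G x y → Walk G y z k → Walk G x z (suc k)

Connected : Graph → Set
Connected G = ∀ x y → ∃[ k ] Walk G x y k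

Dist : (G : Graph) → Fin (n G) → Fin (n G) → ℕ → Set
Dist G x y k = Walk G x y k × (∀ m → m < k → ¬ Walk G x y m)

Distinguishes : (G : Graph) → Fin (n G) → Fin (n G) → Fin (n G) → Set
Distinguishes G z x y = ∀ k l → Dist G x z k → Dist G y z l → k ≢ l

Resolving : (G : Graph) → (Fin (n G) → Set) → Set
Resolving G W = ∀ x y → x ≢ y → ∃[ z ] (W z × Distinguishes G z x y)

record PairingResolvingSet (G : Graph) : Set where
  field
    k      : ℕ
    u      : Fin k → Fin (n G)
    w      : Fin k → Fin (n G)
    u-inj  : ∀ i j → u i ≡ u j → i ≡ j
    w-inj  : ∀ i j → w i ≡ w j → i ≡ j
    uw-dis : ∀ i j → u i ≢ w j
    -- every transversal {x_1,…,x_k}, x_i ∈ {u i, w i}, is resolving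
    resolves : ∀ (c : Fin k → Bool) →
      Resolving G (λ z → ∃[ i ] (z ≡ (if c i then u i else w i)))

data Owner : Set where
  free res spo : Owner

data Player : Set where
  resolver spoiler : Player

Position : Graph → Set
Position G = Fin (n G) → Owner

claim : (G : Graph) → Position G → Fin (n G) → Owner → Position G
claim G p v o z = if ⌊ z ≟ v ⌋ then o else p z

ResolverSet : (G : Graph) → Position G → Fin (n G) → Set
ResolverSet G p z = p z ≡ res

-- ResolverWins G p t : Resolver has a winning strategy from position p
-- with player t to move.  (Inductive, hence a finite winning strategy.)
data ResolverWins (G : Graph) : Position G → Player → Set where
  resolved : ∀ {p t} → Resolving G (ResolverSet G p) → ResolverWins G p t
  rmove    : ∀ {p} v → p v ≡ free →
             ResolverWins G (claim G p v res) spoiler → ResolverWins G p resolver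
  smove    : ∀ {p} → (∃[ v ] p v ≡ free) →
             (∀ v → p v ≡ free → ResolverWins G (claim G p v spo) resolver) →
             ResolverWins G p spoiler

start : (G : Graph) → Position G
start G _ = free

OutcomeR : Graph → Set
OutcomeR G = ResolverWins G (start G) resolver × ResolverWins G (start G) spoiler

module Submission where

-- Resolver wins the Maker–Breaker resolving game on any graph with a pairing
-- resolving set {{u i , w i}}, whoever moves first, by the pairing strategy:
-- whenever Spoiler takes one vertex of a pair whose other vertex is still
-- free, Resolver takes that other vertex; otherwise Resolver takes any free
-- vertex.  This keeps every pair "safe" (both vertices free, or one owned by
-- Resolver), and once the board is full a safe position gives Resolver a
-- vertex of every pair, i.e. a transversal, which is resolving by definition.

open import Defs hiding (sym)
open import Data.Nat using (ℕ; zero; suc; _+_; _≤_; _<_; z≤n; s≤s)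
open import Data.Nat.Properties
  using (≤-refl; ≤-pred; m≤n⇒m≤1+n; ≤-trans; m≤m+n; m≤n+m; <-≤-trans; +-mono-≤; +-mono-<-≤; +-mono-≤-<; n≮0)
open import Data.Fin using (Fin; _≟_) renaming (zero to fz; suc to fs)
open import Data.Fin.Properties using (any?)
open import Data.Bool using (Bool; true; false; if_then_else_)
open import Data.Bool.Properties using (if-float)
open import Data.Product using (∃-syntax; _×_; _,_)
open import Data.Sum using (_⊎_; inj₁; inj₂)
open import Data.Empty using (⊥-elim)
open import Relation.Nullary using (¬_; Dec; yes; no)
open import Relation.Nullary.Decidable using (_×-dec_; _⊎-dec_; map′)
open import Relation.Binary.PropositionalEquality
  using (_≡_; _≢_; refl; sym; trans; subst)
open import Function using (_∘_)

sumFin : ∀ {n} → (Fin n → ℕ) → ℕ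
sumFin {zero}  f = 0
sumFin {suc n} f = f fz + sumFin (f ∘ fs)

sumFin-mono : ∀ {n} (f g : Fin n → ℕ) → (∀ z → g z ≤ f z) → sumFin g ≤ sumFin f
sumFin-mono {zero}  f g le = z≤n
sumFin-mono {suc n} f g le = +-mono-≤ (le fz) (sumFin-mono (f ∘ fs) (g ∘ fs) (le ∘ fs))

sumFin-strict : ∀ {n} (f g : Fin n → ℕ) (v : Fin n) →
                (∀ z → g z ≤ f z) → g v < f v → sumFin g < sumFin f
sumFin-strict {suc n} f g fz     le lt =
  +-mono-<-≤ lt (sumFin-mono (f ∘ fs) (g ∘ fs) (le ∘ fs))
sumFin-strict {suc n} f g (fs v) le lt =
  +-mono-≤-< (le fz) (sumFin-strict (f ∘ fs) (g ∘ fs) v (le ∘ fs) lt)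

sumFin-positive : ∀ {n} (f : Fin n → ℕ) v → 0 < f v → 0 < sumFin f
sumFin-positive f fz     pos = ≤-trans pos (m≤m+n (f fz) _)
sumFin-positive f (fs v) pos = ≤-trans (sumFin-positive (f ∘ fs) v pos) (m≤n+m _ (f fz))

isFree : (o : Owner) → Dec (o ≡ free)
isFree free = yes refl
isFree res  = no λ ()
isFree spo  = no λ ()

freeInd : Owner → ℕ
freeInd free = 1
freeInd res  = 0
freeInd spo  = 0

freeInd-taken : ∀ o → o ≢ free → freeInd o ≡ 0
freeInd-taken free nf = ⊥-elim (nf refl)
freeInd-taken res  nf = refl
freeInd-taken spo  nf = refl

freeCount : ∀ {n} → (Fin n → Owner) → ℕ
freeCount p = sumFin (freeInd ∘ p)

module _ (G : Graph) where

  claim-same : ∀ (p : Position G) v o → claim G p v o v ≡ o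
  claim-same p v o with v ≟ v
  ... | yes _ = refl
  ... | no ne = ⊥-elim (ne refl)

  claim-other : ∀ (p : Position G) v o z → z ≢ v → claim G p v o z ≡ p z
  claim-other p v o z ne with z ≟ v
  ... | yes e = ⊥-elim (ne e)
  ... | no _  = refl

  free⇒positive : ∀ (p : Position G) v → p v ≡ free → 0 < freeCount p
  free⇒positive p v pv = sumFin-positive (freeInd ∘ p) v positive
    where
    positive : 0 < freeInd (p v)
    positive rewrite pv = s≤s z≤n

  claim-spends : ∀ (p : Position G) v o {m} → o ≢ free → p v ≡ free →
                 freeCount p ≤ suc m → freeCount (claim G p v o) ≤ m
  claim-spends p v o nf pv fuel =
    ≤-pred (<-≤-trans (sumFin-strict (freeInd ∘ p) (freeInd ∘ claim G p v o) v pointwise strict) fuel)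
    where
    pointwise : ∀ z → freeInd (claim G p v o z) ≤ freeInd (p z)
    pointwise z with z ≟ v
    ... | yes _ rewrite freeInd-taken o nf = z≤n
    ... | no _  = ≤-refl
    strict : freeInd (claim G p v o v) < freeInd (p v)
    strict rewrite claim-same p v o | freeInd-taken o nf | pv = s≤s z≤n

  anyFree? : ∀ (p : Position G) → Dec (∃[ v ] p v ≡ free)
  anyFree? p = any? λ v → isFree (p v)

SpoilerAnswer : (G : Graph) → (Position G → Set) → Position G → Set
SpoilerAnswer G Good p = Good p ⊎ ∃[ v ] (p v ≡ free × Good (claim G p v res))

-- Induction is on a fuel bound for the number of free vertices.
module InvariantStrategy
  (G : Graph) (Good : Position G → Set)
  (full-resolves    : ∀ p → Good p → (∀ z → p z ≢ free) → Resolving G (ResolverSet G p))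
  (resolver-keeps   : ∀ p v → Good p → Good (claim G p v res))
  (spoiler-answered : ∀ p v → Good p → p v ≡ free → SpoilerAnswer G Good (claim G p v spo))
  where

  wins : ∀ m p t → freeCount p ≤ m → Good p → ResolverWins G p t
  wins m p t fuel good with anyFree? G p
  ... | no full = resolved (full-resolves p good λ z pz → full (z , pz))
  wins zero p t fuel good | yes (v , pv) =
    ⊥-elim (n≮0 (<-≤-trans (free⇒positive G p v pv) fuel))
  wins (suc m) p resolver fuel good | yes (v , pv) =
    rmove v pv (wins m _ spoiler (claim-spends G p v res (λ ()) pv fuel) (resolver-keeps p v good))
  wins (suc m) p spoiler fuel good | yes someFree = smove someFree reply
    where
    reply : ∀ v → p v ≡ free → ResolverWins G (claim G p v spo) resolver
    reply v pv with claim-spends G p v spo (λ ()) pv fuel | spoiler-answered p v good pv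
    ... | fuel′ | inj₁ good′ = wins m _ resolver fuel′ good′
    ... | fuel′ | inj₂ (v′ , pv′ , good′) =
      rmove v′ pv′ (wins m _ spoiler (claim-spends G _ v′ res (λ ()) pv′ (m≤n⇒m≤1+n fuel′)) good′)

module Pairing (G : Graph) (PR : PairingResolvingSet G) where
  open PairingResolvingSet PR

  InPair : Fin k → Fin (n G) → Set
  InPair i z = z ≡ u i ⊎ z ≡ w i

  inPair? : ∀ i z → Dec (InPair i z)
  inPair? i z = (z ≟ u i) ⊎-dec (z ≟ w i)

  inPair-unique : ∀ {i j z} → InPair i z → InPair j z → i ≡ j
  inPair-unique (inj₁ a) (inj₁ b) = u-inj _ _ (trans (sym a) b)
  inPair-unique (inj₁ a) (inj₂ b) = ⊥-elim (uw-dis _ _ (trans (sym a) b))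
  inPair-unique (inj₂ a) (inj₁ b) = ⊥-elim (uw-dis _ _ (trans (sym b) a))
  inPair-unique (inj₂ a) (inj₂ b) = w-inj _ _ (trans (sym a) b)

  Safe : Position G → Fin k → Set
  Safe p i = (p (u i) ≡ free × p (w i) ≡ free) ⊎ (p (u i) ≡ res ⊎ p (w i) ≡ res)

  PairingInvariant : Position G → Set
  PairingInvariant p = ∀ i → Safe p i

  safe-untouched : ∀ p z o i → ¬ InPair i z → Safe p i → Safe (claim G p z o) i
  safe-untouched p z o i out safe
    rewrite claim-other G p z o (u i) (out ∘ inj₁ ∘ sym)
          | claim-other G p z o (w i) (out ∘ inj₂ ∘ sym) = safe

  safe-claimed : ∀ p z i → InPair i z → Safe (claim G p z res) i
  safe-claimed p z i (inj₁ refl) = inj₂ (inj₁ (claim-same G p z res))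
  safe-claimed p z i (inj₂ refl) = inj₂ (inj₂ (claim-same G p z res))

  isRes : Owner → Bool
  isRes res = true
  isRes _   = false

  select-res : ∀ a b → a ≡ res ⊎ b ≡ res → (if isRes a then a else b) ≡ res
  select-res res  b _        = refl
  select-res free b (inj₂ r) = r
  select-res spo  b (inj₂ r) = r

  choice : Position G → Fin k → Bool
  choice p i = isRes (p (u i))

  choice-owned : ∀ p i → p (u i) ≡ res ⊎ p (w i) ≡ res →
                 p (if choice p i then u i else w i) ≡ res
  choice-owned p i owned =
    trans (if-float p (choice p i)) (select-res (p (u i)) (p (w i)) owned)

  -- On a full safe board Resolver owns a transversal, which is resolving.
  full-resolves : ∀ p → PairingInvariant p → (∀ z → p z ≢ free) →
                  Resolving G (ResolverSet G p)
  full-resolves p inv full x y x≢y with resolves (choice p) x y x≢y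
  ... | z , (i , refl) , distinguishes = z , choice-owned p i (owned (inv i)) , distinguishes
    where
    owned : Safe p i → p (u i) ≡ res ⊎ p (w i) ≡ res
    owned (inj₁ (uf , _)) = ⊥-elim (full (u i) uf)
    owned (inj₂ r)        = r

  resolver-keeps : ∀ p v → PairingInvariant p → PairingInvariant (claim G p v res)
  resolver-keeps p v inv i with inPair? i v
  ... | yes m   = safe-claimed p v i m
  ... | no out  = safe-untouched p v res i out (inv i)

  data Threat (p : Position G) (v : Fin (n G)) (i : Fin k) : Set where
    threat-u : v ≡ u i → p (w i) ≡ free → Threat p v i
    threat-w : v ≡ w i → p (u i) ≡ free → Threat p v i

  threat? : ∀ p v i → Dec (Threat p v i)
  threat? p v i =
    map′ fromSum toSum (((v ≟ u i) ×-dec isFree (p (w i))) ⊎-dec ((v ≟ w i) ×-dec isFree (p (u i))))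
    where
    fromSum : (v ≡ u i × p (w i) ≡ free) ⊎ (v ≡ w i × p (u i) ≡ free) → Threat p v i
    fromSum (inj₁ (e , f)) = threat-u e f
    fromSum (inj₂ (e , f)) = threat-w e f
    toSum : Threat p v i → (v ≡ u i × p (w i) ≡ free) ⊎ (v ≡ w i × p (u i) ≡ free)
    toSum (threat-u e f) = inj₁ (e , f)
    toSum (threat-w e f) = inj₂ (e , f)

  threat-inPair : ∀ {p v i} → Threat p v i → InPair i v
  threat-inPair (threat-u e _) = inj₁ e
  threat-inPair (threat-w e _) = inj₂ e

  partner : ∀ {p v i} → Threat p v i → Fin (n G)
  partner {i = i} (threat-u _ _) = w i
  partner {i = i} (threat-w _ _) = u i

  partner-inPair : ∀ {p v i} (t : Threat p v i) → InPair i (partner t)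
  partner-inPair (threat-u _ _) = inj₂ refl
  partner-inPair (threat-w _ _) = inj₁ refl

  partner-free : ∀ {p v i} (t : Threat p v i) → claim G p v spo (partner t) ≡ free
  partner-free {p} {i = i} (threat-u refl wf) = trans (claim-other G p (u i) spo (w i) (uw-dis i i ∘ sym)) wf
  partner-free {p} {i = i} (threat-w refl uf) = trans (claim-other G p (w i) spo (u i) (uw-dis i i)) uf

  -- A Spoiler claim inside a safe, unthreatened pair leaves it safe: the pair
  -- already contains a Resolver vertex, which is not the free vertex v.
  safe-unthreatened : ∀ p v i → p v ≡ free → ¬ Threat p v i → InPair i v →
                      Safe p i → Safe (claim G p v spo) i
  safe-unthreatened p v i pv nt (inj₁ refl) (inj₁ (_ , wf))  = ⊥-elim (nt (threat-u refl wf))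
  safe-unthreatened p v i pv nt (inj₂ refl) (inj₁ (uf , _))  = ⊥-elim (nt (threat-w refl uf))
  safe-unthreatened p v i pv nt (inj₁ refl) (inj₂ (inj₁ r))  with () ← trans (sym pv) r
  safe-unthreatened p v i pv nt (inj₂ refl) (inj₂ (inj₂ r))  with () ← trans (sym pv) r
  safe-unthreatened p v i pv nt (inj₁ refl) (inj₂ (inj₂ r))  =
    inj₂ (inj₂ (trans (claim-other G p v spo (w i) (uw-dis i i ∘ sym)) r))
  safe-unthreatened p v i pv nt (inj₂ refl) (inj₂ (inj₁ r))  =
    inj₂ (inj₁ (trans (claim-other G p v spo (u i) (uw-dis i i)) r))

  spoiler-answered : ∀ p v → PairingInvariant p → p v ≡ free →
                     SpoilerAnswer G PairingInvariant (claim G p v spo)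
  spoiler-answered p v inv pv with any? (threat? p v)
  ... | no noThreat = inj₁ unthreatened
    where
    unthreatened : PairingInvariant (claim G p v spo)
    unthreatened j with inPair? j v
    ... | yes m  = safe-unthreatened p v j pv (noThreat ∘ (j ,_)) m (inv j)
    ... | no out = safe-untouched p v spo j out (inv j)
  ... | yes (i , t) = inj₂ (partner t , partner-free t , answered)
    where
    afterSpoiler : Position G
    afterSpoiler = claim G p v spo

    answered : PairingInvariant (claim G afterSpoiler (partner t) res)
    answered j with inPair? j v
    ... | yes m  = subst (Safe (claim G afterSpoiler (partner t) res)) (inPair-unique (threat-inPair t) m)
                         (safe-claimed afterSpoiler (partner t) i (partner-inPair t))
    ... | no out = safe-untouched afterSpoiler (partner t) res j partnerOut
                                  (safe-untouched p v spo j out (inv j))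
      where
      partnerOut : ¬ InPair j (partner t)
      partnerOut m = out (subst (λ l → InPair l v) (inPair-unique (partner-inPair t) m) (threat-inPair t))

  open InvariantStrategy G PairingInvariant full-resolves resolver-keeps spoiler-answered public

  start-safe : PairingInvariant (start G)
  start-safe i = inj₁ (refl , refl)

proposition3p3 : (G : Graph) → Connected G → PairingResolvingSet G → OutcomeR G
proposition3p3 G _ PR =
  wins _ (start G) resolver ≤-refl start-safe , wins _ (start G) spoiler ≤-refl start-safe
  where open Pairing G PR
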